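{- Let $G$ and $H$ be finite simple graphs, each with at least one edge. Then $\Gamma(G\times H)\ge \Gamma(G)+\Gamma(H)-2$.
   Context: The direct product $G\times H$ has vertex set $V(G)\times V(H)$, and $(a,x)(b,y)$ is an edge iff $ab\in E(G)$ and $xy\in E(H)$. A greedy $k$-colouring of a graph is a partition of its vertex set into $k$ nonempty stable sets $S_1,\dots,S_k$ such that for every $j<i$, every vertex of $S_i$ has a neighbour in $S_j$. The Grundy number $\Gamma$ is the largest such $k$. -}

module Defs where

open import Data.Nat using (ℕ)
open import Data.Fin using (Fin; _<_)
open import Data.Product using (Σ; ∃; _×_; _,_)
open import Relation.Binary.PropositionalEquality using (_≡_)
open import Relation.Nullary using (¬_; Dec)

record Graph : Set₁ where
  field
    n      : ℕ
    E      : Fin n → Fin n → Set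
    E-dec  : ∀ a b → Dec (E a b)
    sym    : ∀ {a b} → E a b → E b a
    irrefl : ∀ {a} → ¬ E a a

open Graph public

HasEdge : Graph → Set
HasEdge G = Σ (Fin (n G)) λ a → Σ (Fin (n G)) λ b → E G a b

-- A greedy k-colouring of a graph with vertex type V and adjacency Adj,
-- given as the map c sending a vertex v to the index i of its class S_i
-- (classes indexed by Fin k, so S_0 ... S_{k-1}).
record GreedyColouring {V : Set} (Adj : V → V → Set) (k : ℕ) : Set where
  field
    colour   : V → Fin k
    nonempty : ∀ (i : Fin k) → ∃ λ v → colour v ≡ i
    stable   : ∀ {u v} → Adj u v → ¬ (colour u ≡ colour v)
    greedy   : ∀ (v : V) (j : Fin k) → j < colour v →
               ∃ λ u → Adj v u × colour u ≡ j

ProdAdj : (G H : Graph) → Fin (n G) × Fin (n H) → Fin (n G) × Fin (n H) → Set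
ProdAdj G H (a , x) (b , y) = E G a b × E H x y

GrundyAtLeast : {V : Set} (Adj : V → V → Set) → ℕ → Set
GrundyAtLeast Adj r = ∃ λ k → (r Data.Nat.≤ k) × GreedyColouring Adj k

-- Let c and d be greedy colourings of G and H with p + 2 and q + 2 colours.  Colour (a, x) by c(a)
-- if c(a) < p and by p + d(x) if a is "raised": of colour p + 1, or of colour p with a neighbour of
-- colour p + 1; the remaining vertices of colour p keep colour p.  Every raised vertex has a raised
-- neighbour, so the greedy property of d lifts to the colours p, …, p + q + 1, while that of c
-- handles the colours below p.  Vertices (a, x) with x isolated get colour 0; they are harmless since
-- every colour class of d contains a non-isolated vertex.
module Submission where

open import Defs renaming (sym to E-sym)
open import Data.Nat using (ℕ; zero; suc; _+_; _∸_; _<_; _≤_; z≤n; s≤s; s≤s⁻¹; z<s; _<?_; _≟_)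
open import Data.Nat.Properties
open import Data.Fin using (Fin; toℕ; fromℕ<)
open import Data.Fin.Properties using (¬Fin0; toℕ<n; toℕ-fromℕ<; toℕ-injective; any?)
open import Data.Product using (∃; _×_; _,_)
open import Data.Sum using (_⊎_; inj₁; inj₂)
open import Function using (_∘_)
open import Relation.Binary.Definitions using (Symmetric)
open import Relation.Nullary using (¬_; Dec; yes; no; contradiction)
open import Relation.Nullary.Decidable using (_×-dec_; _⊎-dec_)
open import Relation.Binary.PropositionalEquality

NonIsolated : {V : Set} → (V → V → Set) → V → Set
NonIsolated Adj x = ∃ (Adj x)

module GreedyColouringℕ {V : Set} {Adj : V → V → Set} {k : ℕ} (c : GreedyColouring Adj k) where
  open GreedyColouring c

  colourℕ : V → ℕ
  colourℕ v = toℕ (colour v)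

  colourℕ<k : ∀ v → colourℕ v < k
  colourℕ<k v = toℕ<n (colour v)

  nonemptyℕ : ∀ t → t < k → ∃ λ v → colourℕ v ≡ t
  nonemptyℕ t t<k = let v , cv≡t = nonempty (fromℕ< t<k) in
    v , trans (cong toℕ cv≡t) (toℕ-fromℕ< t<k)

  stableℕ : ∀ {u v} → Adj u v → colourℕ u ≢ colourℕ v
  stableℕ uv = stable uv ∘ toℕ-injective

  greedyℕ : ∀ v t → t < colourℕ v → ∃ λ u → Adj v u × colourℕ u ≡ t
  greedyℕ v t t<cv =
    let t<k = <-trans t<cv (colourℕ<k v)
        u , vu , cu≡t = greedy v (fromℕ< t<k) (subst (_< colourℕ v) (sym (toℕ-fromℕ< t<k)) t<cv)
    in u , vu , trans (cong toℕ cu≡t) (toℕ-fromℕ< t<k)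

greedyColouring-fromℕ : {V : Set} {Adj : V → V → Set} {k : ℕ} (col : V → ℕ) →
  (∀ v → col v < k) →
  (∀ t → t < k → ∃ λ v → col v ≡ t) →
  (∀ {u v} → Adj u v → col u ≢ col v) →
  (∀ v t → t < col v → ∃ λ u → Adj v u × col u ≡ t) →
  GreedyColouring Adj k
greedyColouring-fromℕ {V} {k = k} col col<k attained stable greedy = record
  { colour   = colour
  ; nonempty = λ i → let v , cv≡i = attained (toℕ i) (toℕ<n i) in v , toFin cv≡i
  ; stable   = λ {u} {v} uv →
      stable uv ∘ subst₂ _≡_ (toℕ-fromℕ< (col<k u)) (toℕ-fromℕ< (col<k v)) ∘ cong toℕ
  ; greedy   = λ v j j<cv →
      let u , vu , cu≡j = greedy v (toℕ j) (subst (toℕ j <_) (toℕ-fromℕ< (col<k v)) j<cv)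
      in u , vu , toFin cu≡j
  }
  where
  colour : V → Fin k
  colour v = fromℕ< (col<k v)

  toFin : ∀ {v i} → col v ≡ toℕ i → colour v ≡ i
  toFin cv≡i = toℕ-injective (trans (toℕ-fromℕ< _) cv≡i)

edge⇒2≤colours : {V : Set} {Adj : V → V → Set} {k : ℕ} {u v : V} →
  Adj u v → GreedyColouring Adj k → 2 ≤ k
edge⇒2≤colours {k = zero} {u} _ c = contradiction (GreedyColouring.colour c u) ¬Fin0
edge⇒2≤colours {k = suc zero} {u} {v} uv c
  with GreedyColouring.colour c u | GreedyColouring.colour c v | GreedyColouring.stable c uv
... | Fin.zero | Fin.zero | cu≢cv = contradiction refl cu≢cv
edge⇒2≤colours {k = suc (suc _)} _ _ = s≤s (s≤s z≤n)

every-class-has-non-isolated : {V : Set} {Adj : V → V → Set} {q : ℕ} → Symmetric Adj →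
  (d : GreedyColouring Adj (suc (suc q))) →
  ∀ t → t < suc (suc q) → ∃ λ x → GreedyColouringℕ.colourℕ d x ≡ t × NonIsolated Adj x
every-class-has-non-isolated adj-sym d zero _ =
  let x , dx≡1 = nonemptyℕ 1 (s≤s (s≤s z≤n))
      y , xy , dy≡0 = greedyℕ x 0 (subst (0 <_) (sym dx≡1) z<s)
  in y , dy≡0 , x , adj-sym xy
  where open GreedyColouringℕ d
every-class-has-non-isolated adj-sym d (suc m) t<k =
  let x , dx≡t = nonemptyℕ (suc m) t<k
      y , xy , _ = greedyℕ x 0 (subst (0 <_) (sym dx≡t) z<s)
  in x , dx≡t , y , xy
  where open GreedyColouringℕ d

module ProductColouring (G H : Graph) {p q : ℕ}
  (c : GreedyColouring (E G) (suc (suc p))) (d : GreedyColouring (E H) (suc (suc q))) where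

  module C = GreedyColouringℕ c
  module D = GreedyColouringℕ d

  HasTopNeighbour : Fin (n G) → Set
  HasTopNeighbour a = ∃ λ b → E G a b × C.colourℕ b ≡ suc p

  Raised : Fin (n G) → Set
  Raised a = C.colourℕ a ≡ suc p ⊎ (C.colourℕ a ≡ p × HasTopNeighbour a)

  raised? : ∀ a → Dec (Raised a)
  raised? a = (C.colourℕ a ≟ suc p) ⊎-dec ((C.colourℕ a ≟ p) ×-dec
                any? (λ b → E-dec G a b ×-dec (C.colourℕ b ≟ suc p)))

  nonIsolated? : ∀ x → Dec (NonIsolated (E H) x)
  nonIsolated? x = any? (E-dec H x)

  raised⇒p≤colour : ∀ {a} → Raised a → p ≤ C.colourℕ a
  raised⇒p≤colour (inj₁ ca≡p+1)     = ≤-trans (n≤1+n p) (≤-reflexive (sym ca≡p+1))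
  raised⇒p≤colour (inj₂ (ca≡p , _)) = ≤-reflexive (sym ca≡p)

  unraised⇒colour≤p : ∀ {a} → ¬ Raised a → C.colourℕ a ≤ p
  unraised⇒colour≤p {a} ¬ra = s≤s⁻¹ (≤∧≢⇒< (s≤s⁻¹ (C.colourℕ<k a)) (¬ra ∘ inj₁))

  raised-neighbour : ∀ {a} → Raised a → ∃ λ b → E G a b × Raised b
  raised-neighbour {a} (inj₁ ca≡p+1) =
    let b , ab , cb≡p = C.greedyℕ a p (subst (p <_) (sym ca≡p+1) (n<1+n p))
    in b , ab , inj₂ (cb≡p , a , E-sym G ab , ca≡p+1)
  raised-neighbour (inj₂ (_ , b , ab , cb≡p+1)) = b , ab , inj₁ cb≡p+1

  -- A raised and an unraised end of an edge could only clash at colour p.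
  raised-unraised-edge : ∀ {a b} → E G a b → Raised a → ¬ Raised b → C.colourℕ b ≢ p
  raised-unraised-edge {a} ab (inj₁ ca≡p+1) ¬rb cb≡p = ¬rb (inj₂ (cb≡p , a , E-sym G ab , ca≡p+1))
  raised-unraised-edge ab (inj₂ (ca≡p , _)) _ cb≡p = C.stableℕ ab (trans ca≡p (sym cb≡p))

  productColour : Fin (n G) × Fin (n H) → ℕ
  productColour (a , x) with nonIsolated? x | raised? a
  ... | no _  | _     = 0
  ... | yes _ | yes _ = p + D.colourℕ x
  ... | yes _ | no _  = C.colourℕ a

  colour-raised : ∀ {a x} → NonIsolated (E H) x → Raised a → productColour (a , x) ≡ p + D.colourℕ x
  colour-raised {a} {x} nx ra with nonIsolated? x | raised? a
  ... | no ¬nx | _      = contradiction nx ¬nx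
  ... | yes _  | yes _  = refl
  ... | yes _  | no ¬ra = contradiction ra ¬ra

  colour-unraised : ∀ {a x} → NonIsolated (E H) x → ¬ Raised a → productColour (a , x) ≡ C.colourℕ a
  colour-unraised {a} {x} nx ¬ra with nonIsolated? x | raised? a
  ... | no ¬nx | _     = contradiction nx ¬nx
  ... | yes _  | yes ra = contradiction ra ¬ra
  ... | yes _  | no _  = refl

  colour-below-p : ∀ {a x} → NonIsolated (E H) x → C.colourℕ a < p → productColour (a , x) ≡ C.colourℕ a
  colour-below-p nx ca<p = colour-unraised nx (<⇒≱ ca<p ∘ raised⇒p≤colour)

  productColour<K : ∀ v → productColour v < p + suc (suc q)
  productColour<K (a , x) with nonIsolated? x | raised? a
  ... | no _  | _      = <-≤-trans z<s (m≤n+m (suc (suc q)) p)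
  ... | yes _ | yes _  = +-monoʳ-< p (D.colourℕ<k x)
  ... | yes _ | no ¬ra = ≤-<-trans (unraised⇒colour≤p ¬ra) (m<m+n p z<s)

  productColour-attained : ∀ t → t < p + suc (suc q) → ∃ λ v → productColour v ≡ t
  productColour-attained t t<K with t <? p
  ... | yes t<p =
    let a , ca≡t = C.nonemptyℕ t (m<n⇒m<1+n (m<n⇒m<1+n t<p))
        x , _ , nx = every-class-has-non-isolated (E-sym H) d 0 z<s
    in (a , x) , trans (colour-below-p nx (subst (_< p) (sym ca≡t) t<p)) ca≡t
  ... | no t≮p with m≤n⇒∃[o]m+o≡n (≮⇒≥ t≮p)
  ...   | m , refl =
    let x , dx≡m , nx = every-class-has-non-isolated (E-sym H) d m (+-cancelˡ-< p m _ t<K)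
        a , ca≡p+1 = C.nonemptyℕ (suc p) ≤-refl
    in (a , x) , trans (colour-raised nx (inj₁ ca≡p+1)) (cong (p +_) dx≡m)

  productColour-stable : ∀ {u v} → ProdAdj G H u v → productColour u ≢ productColour v
  productColour-stable {a , x} {b , y} (ab , xy) = clash (raised? a) (raised? b) (y , xy) (x , E-sym H xy)
    where
    squeeze : ∀ {m c} → p + m ≡ c → c ≤ p → c ≡ p
    squeeze {m} p+m≡c c≤p = ≤-antisym c≤p (≤-trans (m≤m+n p m) (≤-reflexive p+m≡c))

    clash : Dec (Raised a) → Dec (Raised b) → NonIsolated (E H) x → NonIsolated (E H) y →
            productColour (a , x) ≢ productColour (b , y)
    clash (yes ra) (yes rb) nx ny eq =
      D.stableℕ xy (+-cancelˡ-≡ p _ _ (subst₂ _≡_ (colour-raised nx ra) (colour-raised ny rb) eq))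
    clash (no ¬ra) (no ¬rb) nx ny eq =
      C.stableℕ ab (subst₂ _≡_ (colour-unraised nx ¬ra) (colour-unraised ny ¬rb) eq)
    clash (yes ra) (no ¬rb) nx ny eq = raised-unraised-edge ab ra ¬rb
      (squeeze (subst₂ _≡_ (colour-raised nx ra) (colour-unraised ny ¬rb) eq) (unraised⇒colour≤p ¬rb))
    clash (no ¬ra) (yes rb) nx ny eq = raised-unraised-edge (E-sym G ab) rb ¬ra
      (squeeze (subst₂ _≡_ (colour-raised ny rb) (colour-unraised nx ¬ra) (sym eq)) (unraised⇒colour≤p ¬ra))

  lower-neighbour : ∀ a x → NonIsolated (E H) x → ∀ t → t < p → t < C.colourℕ a →
                    ∃ λ u → ProdAdj G H (a , x) u × productColour u ≡ t
  lower-neighbour a x (x′ , xx′) t t<p t<ca =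
    let b , ab , cb≡t = C.greedyℕ a t t<ca
    in (b , x′) , (ab , xx′) , trans (colour-below-p (x , E-sym H xx′) (subst (_< p) (sym cb≡t) t<p)) cb≡t

  upper-neighbour : ∀ a x → Raised a → ∀ m → m < D.colourℕ x →
                    ∃ λ u → ProdAdj G H (a , x) u × productColour u ≡ p + m
  upper-neighbour a x ra m m<dx =
    let y , xy , dy≡m = D.greedyℕ x m m<dx
        b , ab , rb = raised-neighbour ra
    in (b , y) , (ab , xy) , trans (colour-raised (x , E-sym H xy) rb) (cong (p +_) dy≡m)

  productColour-greedy : ∀ v t → t < productColour v → ∃ λ u → ProdAdj G H v u × productColour u ≡ t
  productColour-greedy (a , x) t t<col with nonIsolated? x | raised? a
  ... | no _   | _      = contradiction t<col λ ()
  ... | yes nx | no ¬ra = lower-neighbour a x nx t (<-≤-trans t<col (unraised⇒colour≤p ¬ra)) t<col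
  ... | yes nx | yes ra with t <? p
  ...   | yes t<p = lower-neighbour a x nx t t<p (<-≤-trans t<p (raised⇒p≤colour ra))
  ...   | no t≮p with m≤n⇒∃[o]m+o≡n (≮⇒≥ t≮p)
  ...     | m , refl = upper-neighbour a x ra m (+-cancelˡ-< p m _ t<col)

  greedyColouring : GreedyColouring (ProdAdj G H) (p + suc (suc q))
  greedyColouring = greedyColouring-fromℕ productColour productColour<K productColour-attained
    productColour-stable productColour-greedy

theorem37 : (G H : Graph) → HasEdge G → HasEdge H →
            ∀ (k l : ℕ) → GreedyColouring (E G) k → GreedyColouring (E H) l →
            GrundyAtLeast (ProdAdj G H) (k + l ∸ 2)
theorem37 G H (_ , _ , ab) (_ , _ , xy) k l c d with edge⇒2≤colours ab c | edge⇒2≤colours xy d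
... | s≤s (s≤s _) | s≤s (s≤s _) = _ , ≤-refl , ProductColouring.greedyColouring G H c d
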